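{- Let $p$ be a prime, $d>e\ge1$ coprime integers, $t$ an integer, $n\ge0$, and $\tau\in S_n^*$. Then $$\sum_{i=0}^n\phi(pi-\tau(i)+t)\ge\frac1d\left(\frac{(p-1)n(n+1)}{2}+(n+1)t+(d-e)C_{t,n}\right).$$
   Context: For an integer $k$, $\phi(k)=\min\{x+y: dx+ey=k,\ x,y\in\mathbb{N}\}\in\mathbb{N}\cup\{+\infty\}$, with the minimum of the empty set being $+\infty$. $S_n^*$ is the set of permutations of $\{0,\dots,n\}$; $\overline{x}$ is the least non-negative residue of $x$ mod $d$ and $e^{ -1}$ the inverse of $e$ mod $d$; $C_{t,n}=\min_{\tau\in S_n^*}\sum_{i=0}^n\overline{e^{ -1}(pi-\tau(i)+t)}$. -}

module Defs where

open import Data.Nat as ℕ using (ℕ; zero; suc; NonZero)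
open import Data.Integer as ℤ using (ℤ; +_; -[1+_])
open import Data.Integer.DivMod using (_%ℕ_)
open import Data.Fin using (Fin; toℕ)
open import Data.Fin.Permutation using (Permutation′; _⟨$⟩ʳ_)
open import Data.List using (List; []; _∷_; upTo; allFin; map; foldr; concatMap)
open import Data.Bool using (if_then_else_)
open import Data.Product using (_×_; ∃; _,_)
open import Relation.Binary.PropositionalEquality using (_≡_)
open import Data.Unit using (⊤)

data ℕ∞ : Set where
  fin : ℕ → ℕ∞
  ∞   : ℕ∞

min∞ : ℕ∞ → ℕ∞ → ℕ∞
min∞ (fin a) (fin b) = fin (a ℕ.⊓ b)
min∞ (fin a) ∞       = fin a
min∞ ∞       b       = b

_+∞_ : ℕ∞ → ℕ∞ → ℕ∞
fin a +∞ fin b = fin (a ℕ.+ b)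
fin a +∞ ∞     = ∞
∞     +∞ _     = ∞

_·∞_ : ℕ → ℕ∞ → ℕ∞
c ·∞ fin a = fin (c ℕ.* a)
c ·∞ ∞     = ∞

_≤∞_ : ℤ → ℕ∞ → Set
z ≤∞ fin a = z ℤ.≤ + a
z ≤∞ ∞     = ⊤

minList∞ : List ℕ∞ → ℕ∞
minList∞ = foldr min∞ ∞

-- φ(k) = min { x + y : d x + e y = k, x, y ∈ ℕ }  (min ∅ = +∞).
-- For k < 0 there are no solutions.  For k = m ≥ 0 and d, e ≥ 1 every
-- solution has x, y ≤ m, so we minimise over (x , y) ∈ [0..m]².
φ : (d e : ℕ) → ℤ → ℕ∞
φ d e -[1+ _ ] = ∞
φ d e (+ m) =
  minList∞ (concatMap (λ x → map (λ y →
     if (d ℕ.* x ℕ.+ e ℕ.* y) ℕ.≡ᵇ m then fin (x ℕ.+ y) else ∞)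
     (upTo (suc m))) (upTo (suc m)))

Σℕ : (n : ℕ) → (Fin (suc n) → ℕ) → ℕ
Σℕ n f = foldr ℕ._+_ 0 (map f (allFin (suc n)))

Σ∞ : (n : ℕ) → (Fin (suc n) → ℕ∞) → ℕ∞
Σ∞ n f = foldr _+∞_ (fin 0) (map f (allFin (suc n)))

arg : (p : ℕ) (t : ℤ) (n : ℕ) (τ : Permutation′ (suc n)) → Fin (suc n) → ℤ
arg p t n τ i = (+ (p ℕ.* toℕ i) ℤ.- + toℕ (τ ⟨$⟩ʳ i)) ℤ.+ t

-- Σ_{i=0}^n \overline{e^{-1}(p i − τ(i) + t)}, where einv is an inverse of e mod d
-- and \overline{x} is the least non-negative residue of x mod d.
costC : (d : ℕ) .{{_ : NonZero d}} (einv p : ℕ) (t : ℤ) (n : ℕ) → Permutation′ (suc n) → ℕ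
costC d einv p t n τ = Σℕ n (λ i → ((+ einv) ℤ.* arg p t n τ i) %ℕ d)

IsC : (d : ℕ) .{{_ : NonZero d}} (einv p : ℕ) (t : ℤ) (n : ℕ) → ℕ → Set
IsC d einv p t n C =
  (∃ λ (σ : Permutation′ (suc n)) → costC d einv p t n σ ≡ C)
  × (∀ (σ : Permutation′ (suc n)) → C ℕ.≤ costC d einv p t n σ)

{-# OPTIONS --safe #-}
-- If φ(k) = x + y with d x + e y = k, then e⁻¹ k ≡ y (mod d), so the residue r of e⁻¹ k
-- is at most y and k + (d − e) r ≤ d x + e y + (d − e) y = d φ(k).  Summing over i, the
-- arguments p i − τ(i) + t add up to (p − 1) n (n + 1)/2 + (n + 1) t because τ permutes
-- {0, …, n}, while the residues add up to a value of the cost function, which is ≥ C_{t,n}.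
module Submission where

open import Defs
open import Data.Nat as ℕ using (ℕ; zero; suc; _+_; _*_; _∸_; _≤_; _<_; _%_; NonZero)
import Data.Nat.Properties as ℕ
open import Data.Nat.DivMod using (m%n≤m; [m+kn]%n≡m%n; %-distribˡ-*; m%n%n≡m%n)
open import Data.Nat.ListAction using (sum)
open import Data.Nat.Primality using (Prime; ¬prime[0])
open import Data.Nat.Coprimality using (Coprime)
open import Data.Integer as ℤ using (ℤ; +_; -[1+_])
import Data.Integer.Properties as ℤ
open import Data.Fin as Fin using (Fin; toℕ)
open import Data.Fin.Properties using (toℕ-inject₁; toℕ-fromℕ)
open import Data.Fin.Permutation using (Permutation′; _⟨$⟩ʳ_)
open import Data.List using (List; []; _∷_; map; foldr; length; tabulate; allFin; upTo)
open import Data.List.Properties using (map-tabulate; length-tabulate)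
open import Data.List.Membership.Propositional using (_∈_)
open import Data.List.Relation.Unary.Any using (here; there; satisfied)
open import Data.List.Relation.Unary.Any.Properties using (concatMap⁻; map⁻)
open import Data.Bool using (true; T; if_then_else_)
open import Data.Product using (_×_; _,_; ∃₂)
open import Data.Sum using (_⊎_; inj₁; inj₂)
open import Data.Unit using (tt)
open import Data.Empty using (⊥-elim)
open import Function using (_∘_)
open import Relation.Binary.PropositionalEquality
open import Algebra.Properties.CommutativeMonoid.Sum ℕ.+-0-commutativeMonoid
  using (sum-permute; sum-init-last; sum-cong-≗) renaming (sum to ∑)

sumℤ : List ℤ → ℤ
sumℤ = foldr ℤ._+_ (+ 0)

sum∞ : List ℕ∞ → ℕ∞
sum∞ = foldr _+∞_ (fin 0)

min∞-sel : ∀ u v → min∞ u v ≡ u ⊎ min∞ u v ≡ v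
min∞-sel (fin a) (fin b) with ℕ.⊓-sel a b
... | inj₁ a⊓b≡a = inj₁ (cong fin a⊓b≡a)
... | inj₂ a⊓b≡b = inj₂ (cong fin a⊓b≡b)
min∞-sel (fin a) ∞ = inj₁ refl
min∞-sel ∞ v = inj₂ refl

minList∞-∈ : ∀ us {m} → minList∞ us ≡ fin m → fin m ∈ us
minList∞-∈ [] ()
minList∞-∈ (u ∷ us) eq with min∞-sel u (minList∞ us)
... | inj₁ min≡u = here (trans (sym eq) min≡u)
... | inj₂ min≡rest = there (minList∞-∈ us (trans (sym min≡rest) eq))

·∞-distribˡ-+∞ : ∀ c u v → c ·∞ (u +∞ v) ≡ (c ·∞ u) +∞ (c ·∞ v)
·∞-distribˡ-+∞ c (fin a) (fin b) = cong fin (ℕ.*-distribˡ-+ c a b)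
·∞-distribˡ-+∞ c (fin a) ∞ = refl
·∞-distribˡ-+∞ c ∞ v = refl

·∞-assoc : ∀ c d u → c ·∞ (d ·∞ u) ≡ (c * d) ·∞ u
·∞-assoc c d (fin a) = cong fin (sym (ℕ.*-assoc c d a))
·∞-assoc c d ∞ = refl

≤-≤∞-trans : ∀ {i j u} → i ℤ.≤ j → j ≤∞ u → i ≤∞ u
≤-≤∞-trans {u = fin a} i≤j j≤a = ℤ.≤-trans i≤j j≤a
≤-≤∞-trans {u = ∞} i≤j j≤∞ = tt

+-mono-≤∞ : ∀ {i j u v} → i ≤∞ u → j ≤∞ v → (i ℤ.+ j) ≤∞ (u +∞ v)
+-mono-≤∞ {i} {j} {fin a} {fin b} i≤a j≤b =
  subst (λ z → i ℤ.+ j ℤ.≤ z) (sym (ℤ.pos-+ a b)) (ℤ.+-mono-≤ i≤a j≤b)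
+-mono-≤∞ {u = fin a} {v = ∞} i≤a j≤∞ = tt
+-mono-≤∞ {u = ∞} i≤∞ j≤v = tt

*-mono-≤∞ : ∀ c {i u} → i ≤∞ u → (+ c ℤ.* i) ≤∞ (c ·∞ u)
*-mono-≤∞ c {i} {fin a} i≤a =
  subst (λ z → + c ℤ.* i ℤ.≤ z) (sym (ℤ.pos-* c a)) (ℤ.*-monoˡ-≤-nonNeg (+ c) i≤a)
*-mono-≤∞ c {u = ∞} i≤∞ = tt

sumℤ-≤∞-·∞-sum∞ : ∀ {A : Set} c (g : A → ℤ) (f : A → ℕ∞) →
  (∀ a → g a ≤∞ (c ·∞ f a)) → ∀ xs → sumℤ (map g xs) ≤∞ (c ·∞ sum∞ (map f xs))
sumℤ-≤∞-·∞-sum∞ c g f g≤cf [] = ℤ.+≤+ ℕ.z≤n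
sumℤ-≤∞-·∞-sum∞ c g f g≤cf (x ∷ xs) =
  subst (λ u → _ ≤∞ u) (sym (·∞-distribˡ-+∞ c (f x) (sum∞ (map f xs))))
    (+-mono-≤∞ (g≤cf x) (sumℤ-≤∞-·∞-sum∞ c g f g≤cf xs))

module _ {A : Set} where

  open ≡-Reasoning

  sumℤ-map-+ : ∀ (f g : A → ℤ) xs →
    sumℤ (map (λ a → f a ℤ.+ g a) xs) ≡ sumℤ (map f xs) ℤ.+ sumℤ (map g xs)
  sumℤ-map-+ f g [] = refl
  sumℤ-map-+ f g (x ∷ xs) = begin
    (f x ℤ.+ g x) ℤ.+ sumℤ (map (λ a → f a ℤ.+ g a) xs)
      ≡⟨ cong (λ s → (f x ℤ.+ g x) ℤ.+ s) (sumℤ-map-+ f g xs) ⟩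
    (f x ℤ.+ g x) ℤ.+ (sumℤ (map f xs) ℤ.+ sumℤ (map g xs))
      ≡⟨ solve 4 (λ a b c d → (a :+ b) :+ (c :+ d) := (a :+ c) :+ (b :+ d)) refl
           (f x) (g x) (sumℤ (map f xs)) (sumℤ (map g xs)) ⟩
    (f x ℤ.+ sumℤ (map f xs)) ℤ.+ (g x ℤ.+ sumℤ (map g xs)) ∎
    where open import Data.Integer.Solver using (module +-*-Solver)
          open +-*-Solver

  sumℤ-map-neg : ∀ (f : A → ℤ) xs → sumℤ (map (λ a → ℤ.- f a) xs) ≡ ℤ.- sumℤ (map f xs)
  sumℤ-map-neg f [] = refl
  sumℤ-map-neg f (x ∷ xs) = begin
    ℤ.- f x ℤ.+ sumℤ (map (λ a → ℤ.- f a) xs) ≡⟨ cong (λ s → ℤ.- f x ℤ.+ s) (sumℤ-map-neg f xs) ⟩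
    ℤ.- f x ℤ.+ ℤ.- sumℤ (map f xs)           ≡⟨ ℤ.neg-distrib-+ (f x) (sumℤ (map f xs)) ⟨
    ℤ.- (f x ℤ.+ sumℤ (map f xs))             ∎

  sumℤ-map-const : ∀ (z : ℤ) (xs : List A) → sumℤ (map (λ _ → z) xs) ≡ + length xs ℤ.* z
  sumℤ-map-const z [] = refl
  sumℤ-map-const z (x ∷ xs) = begin
    z ℤ.+ sumℤ (map (λ _ → z) xs) ≡⟨ cong (λ s → z ℤ.+ s) (sumℤ-map-const z xs) ⟩
    z ℤ.+ + length xs ℤ.* z       ≡⟨ ℤ.suc-* (+ length xs) z ⟨
    + suc (length xs) ℤ.* z       ∎

  sumℤ-map-pos : ∀ (f : A → ℕ) xs → sumℤ (map (λ a → + f a) xs) ≡ + sum (map f xs)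
  sumℤ-map-pos f [] = refl
  sumℤ-map-pos f (x ∷ xs) = begin
    + f x ℤ.+ sumℤ (map (λ a → + f a) xs) ≡⟨ cong (λ s → + f x ℤ.+ s) (sumℤ-map-pos f xs) ⟩
    + f x ℤ.+ + sum (map f xs)           ≡⟨ ℤ.pos-+ (f x) (sum (map f xs)) ⟨
    + (f x + sum (map f xs))             ∎

  sum-map-*ˡ : ∀ c (f : A → ℕ) xs → sum (map (λ a → c * f a) xs) ≡ c * sum (map f xs)
  sum-map-*ˡ c f [] = sym (ℕ.*-zeroʳ c)
  sum-map-*ˡ c f (x ∷ xs) = begin
    c * f x + sum (map (λ a → c * f a) xs) ≡⟨ cong (λ s → c * f x + s) (sum-map-*ˡ c f xs) ⟩
    c * f x + c * sum (map f xs)           ≡⟨ ℕ.*-distribˡ-+ c (f x) (sum (map f xs)) ⟨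
    c * (f x + sum (map f xs))             ∎

sum-map-allFin : ∀ {m} (f : Fin m → ℕ) → sum (map f (allFin m)) ≡ ∑ f
sum-map-allFin f = trans (cong sum (map-tabulate (λ i → i) f)) (sum-tabulate f)
  where
  sum-tabulate : ∀ {m} (g : Fin m → ℕ) → sum (tabulate g) ≡ ∑ g
  sum-tabulate {zero} g = refl
  sum-tabulate {suc m} g = cong (λ s → g Fin.zero + s) (sum-tabulate (g ∘ Fin.suc))

sum-map-allFin-permute : ∀ {m} (f : Fin m → ℕ) (π : Permutation′ m) →
  sum (map (f ∘ (π ⟨$⟩ʳ_)) (allFin m)) ≡ sum (map f (allFin m))
sum-map-allFin-permute f π = begin
  sum (map (f ∘ (π ⟨$⟩ʳ_)) (allFin _)) ≡⟨ sum-map-allFin (f ∘ (π ⟨$⟩ʳ_)) ⟩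
  ∑ (f ∘ (π ⟨$⟩ʳ_))                   ≡⟨ sum-permute f π ⟨
  ∑ f                                  ≡⟨ sum-map-allFin f ⟨
  sum (map f (allFin _))               ∎
  where open ≡-Reasoning

double-∑-toℕ : ∀ n → 2 * ∑ (toℕ {suc n}) ≡ n * suc n
double-∑-toℕ zero = refl
double-∑-toℕ (suc n) = begin
  2 * ∑ (toℕ {suc (suc n)})       ≡⟨ cong (2 *_) (sum-init-last (toℕ {suc (suc n)})) ⟩
  2 * (∑ (toℕ {suc (suc n)} ∘ Fin.inject₁) + toℕ (Fin.fromℕ (suc n)))
    ≡⟨ cong₂ (λ a b → 2 * (a + b)) (sum-cong-≗ (toℕ-inject₁ {suc n})) (toℕ-fromℕ (suc n)) ⟩
  2 * (∑ (toℕ {suc n}) + suc n)   ≡⟨ ℕ.*-distribˡ-+ 2 (∑ (toℕ {suc n})) (suc n) ⟩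
  2 * ∑ (toℕ {suc n}) + 2 * suc n ≡⟨ cong (_+ 2 * suc n) (double-∑-toℕ n) ⟩
  n * suc n + 2 * suc n           ≡⟨ solve 1 (λ m → m :* (con 1 :+ m) :+ con 2 :* (con 1 :+ m)
                                               := (con 1 :+ m) :* (con 2 :+ m)) refl n ⟩
  suc n * suc (suc n)             ∎
  where open ≡-Reasoning
        open import Data.Nat.Solver using (module +-*-Solver)
        open +-*-Solver

if-then-fin : ∀ b {a m} → fin m ≡ (if b then fin a else ∞) → T b × m ≡ a
if-then-fin true refl = tt , refl

φ-candidate : (d e k x y : ℕ) → ℕ∞
φ-candidate d e k x y = if d * x + e * y ℕ.≡ᵇ k then fin (x + y) else ∞

φ-solution : ∀ d e k {m} → φ d e k ≡ fin m → ∃₂ λ x y → k ≡ + (d * x + e * y) × m ≡ x + y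
φ-solution d e -[1+ _ ] ()
φ-solution d e (+ k) eq
  with x , hit-x ← satisfied (concatMap⁻ (λ x → map (φ-candidate d e k x) (upTo (suc k)))
                                         {xs = upTo (suc k)} (minList∞-∈ _ eq))
  with y , hit-y ← satisfied (map⁻ {f = φ-candidate d e k x} hit-x)
  with solves , m≡x+y ← if-then-fin (d * x + e * y ℕ.≡ᵇ k) hit-y
  = x , y , cong +_ (sym (ℕ.≡ᵇ⇒≡ _ _ solves)) , m≡x+y

weighted-residue-bound : ∀ {d e r} x y → e ≤ d → r ≤ y → d * x + e * y + (d ∸ e) * r ≤ d * (x + y)
weighted-residue-bound {d} {e} {r} x y e≤d r≤y = begin
  d * x + e * y + (d ∸ e) * r   ≤⟨ ℕ.+-monoʳ-≤ (d * x + e * y) (ℕ.*-monoʳ-≤ (d ∸ e) r≤y) ⟩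
  d * x + e * y + (d ∸ e) * y   ≡⟨ ℕ.+-assoc (d * x) (e * y) ((d ∸ e) * y) ⟩
  d * x + (e * y + (d ∸ e) * y) ≡⟨ cong (λ s → d * x + s) (ℕ.*-distribʳ-+ y e (d ∸ e)) ⟨
  d * x + (e + (d ∸ e)) * y     ≡⟨ cong (λ c → d * x + c * y) (ℕ.m+[n∸m]≡n e≤d) ⟩
  d * x + d * y                 ≡⟨ ℕ.*-distribˡ-+ d x y ⟨
  d * (x + y)                   ∎
  where open ℕ.≤-Reasoning

module _ (d e einv : ℕ) .{{_ : NonZero d}} (inverse : (e * einv) % d ≡ 1) where

  inverse-residue : ∀ x y → (einv * (d * x + e * y)) % d ≡ y % d
  inverse-residue x y = begin
    (einv * (d * x + e * y)) % d
      ≡⟨ cong (_% d) (solve 4 (λ a b c f → a :* (b :* c :+ f) := a :* f :+ (a :* c) :* b)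
                              refl einv d x (e * y)) ⟩
    (einv * (e * y) + (einv * x) * d) % d ≡⟨ [m+kn]%n≡m%n (einv * (e * y)) (einv * x) d ⟩
    (einv * (e * y)) % d
      ≡⟨ cong (_% d) (solve 3 (λ a b c → a :* (b :* c) := (b :* a) :* c) refl einv e y) ⟩
    ((e * einv) * y) % d                  ≡⟨ %-distribˡ-* (e * einv) y d ⟩
    (((e * einv) % d) * (y % d)) % d      ≡⟨ cong (λ z → (z * (y % d)) % d) inverse ⟩
    (1 * (y % d)) % d                     ≡⟨ cong (_% d) (ℕ.*-identityˡ (y % d)) ⟩
    (y % d) % d                           ≡⟨ m%n%n≡m%n y d ⟩
    y % d                                 ∎
    where open ≡-Reasoning
          open import Data.Nat.Solver using (module +-*-Solver)
          open +-*-Solver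

  φ-bound : e ≤ d → ∀ k → (k ℤ.+ + ((d ∸ e) * ((+ einv ℤ.* k) ℤ.%ℕ d))) ≤∞ (d ·∞ φ d e k)
  φ-bound e≤d k with φ d e k in eq
  ... | ∞ = tt
  ... | fin m with φ-solution d e k eq
  ... | x , y , refl , refl = begin
    + N ℤ.+ + ((d ∸ e) * ((+ einv ℤ.* + N) ℤ.%ℕ d)) ≡⟨ cong (λ r → + N ℤ.+ + ((d ∸ e) * r)) residue ⟩
    + N ℤ.+ + ((d ∸ e) * (y % d))                 ≡⟨ ℤ.pos-+ N ((d ∸ e) * (y % d)) ⟨
    + (N + (d ∸ e) * (y % d))                     ≤⟨ ℤ.+≤+ (weighted-residue-bound x y e≤d (m%n≤m y d)) ⟩
    + (d * (x + y))                               ∎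
    where
    open ℤ.≤-Reasoning
    N = d * x + e * y
    residue : (+ einv ℤ.* + N) ℤ.%ℕ d ≡ y % d
    residue = trans (cong (ℤ._%ℕ d) (sym (ℤ.pos-* einv N))) (inverse-residue x y)

sumℤ-arg : ∀ p t n (τ : Permutation′ (suc n)) →
  sumℤ (map (arg p t n τ) (allFin (suc n))) ≡ (+ (p * Σℕ n toℕ) ℤ.- + Σℕ n toℕ) ℤ.+ + suc n ℤ.* t
sumℤ-arg p t n τ = begin
  sumℤ (map (arg p t n τ) is)
    ≡⟨ sumℤ-map-+ (λ i → pi i ℤ.- τi i) (λ _ → t) is ⟩
  sumℤ (map (λ i → pi i ℤ.- τi i) is) ℤ.+ sumℤ (map (λ _ → t) is)
    ≡⟨ cong₂ ℤ._+_ (sumℤ-map-+ pi (λ i → ℤ.- τi i) is) (sumℤ-map-const t is) ⟩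
  (sumℤ (map pi is) ℤ.+ sumℤ (map (λ i → ℤ.- τi i) is)) ℤ.+ + length is ℤ.* t
    ≡⟨ cong₂ (λ a b → (sumℤ (map pi is) ℤ.+ a) ℤ.+ + b ℤ.* t)
         (sumℤ-map-neg τi is) (length-tabulate {n = suc n} (λ i → i)) ⟩
  (sumℤ (map pi is) ℤ.- sumℤ (map τi is)) ℤ.+ + suc n ℤ.* t
    ≡⟨ cong₂ (λ a b → (a ℤ.- b) ℤ.+ + suc n ℤ.* t)
         (sumℤ-map-pos (λ i → p * toℕ i) is) (sumℤ-map-pos (toℕ ∘ (τ ⟨$⟩ʳ_)) is) ⟩
  (+ sum (map (λ i → p * toℕ i) is) ℤ.- + sum (map (toℕ ∘ (τ ⟨$⟩ʳ_)) is)) ℤ.+ + suc n ℤ.* t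
    ≡⟨ cong₂ (λ a b → (+ a ℤ.- + b) ℤ.+ + suc n ℤ.* t)
         (sum-map-*ˡ p toℕ is) (sum-map-allFin-permute toℕ τ) ⟩
  (+ (p * Σℕ n toℕ) ℤ.- + Σℕ n toℕ) ℤ.+ + suc n ℤ.* t ∎
  where
  open ≡-Reasoning
  is = allFin (suc n)
  pi τi : Fin (suc n) → ℤ
  pi i = + (p * toℕ i)
  τi i = + toℕ (τ ⟨$⟩ʳ i)

-- With 2 S = n (n + 1), the left side of the theorem is twice (argument sum + (d − e) C).
double-rearrange : ∀ p n S a C (z : ℤ) → 2 * S ≡ n * suc n →
  + (p * n * suc n) ℤ.+ + 2 ℤ.* z ℤ.+ + (2 * a * C)
    ≡ + 2 ℤ.* (((+ (suc p * S) ℤ.- + S) ℤ.+ z) ℤ.+ + (a * C))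
double-rearrange p n S a C z 2S≡n[n+1] = begin
  + (p * n * suc n) ℤ.+ + 2 ℤ.* z ℤ.+ + (2 * a * C)
    ≡⟨ cong₂ (λ u v → + u ℤ.+ + 2 ℤ.* z ℤ.+ + v)
         (trans (ℕ.*-assoc p n (suc n)) (cong (p *_) (sym 2S≡n[n+1]))) (ℕ.*-assoc 2 a C) ⟩
  + (p * (2 * S)) ℤ.+ + 2 ℤ.* z ℤ.+ + (2 * (a * C))
    ≡⟨ cong₂ (λ u v → u ℤ.+ + 2 ℤ.* z ℤ.+ v)
         (trans (ℤ.pos-* p (2 * S)) (cong (+ p ℤ.*_) (ℤ.pos-* 2 S))) (ℤ.pos-* 2 (a * C)) ⟩
  + p ℤ.* (+ 2 ℤ.* + S) ℤ.+ + 2 ℤ.* z ℤ.+ + 2 ℤ.* + (a * C)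
    ≡⟨ solve 4 (λ P s x c → P :* (con (+ 2) :* s) :+ con (+ 2) :* x :+ con (+ 2) :* c
                   := con (+ 2) :* ((((s :+ P :* s) :- s) :+ x) :+ c)) refl (+ p) (+ S) z (+ (a * C)) ⟩
  + 2 ℤ.* (((+ S ℤ.+ + p ℤ.* + S ℤ.- + S) ℤ.+ z) ℤ.+ + (a * C))
    ≡⟨ cong (λ u → + 2 ℤ.* (((u ℤ.- + S) ℤ.+ z) ℤ.+ + (a * C)))
         (trans (ℤ.pos-+ S (p * S)) (cong (λ u → + S ℤ.+ u) (ℤ.pos-* p S))) ⟨
  + 2 ℤ.* (((+ (suc p * S) ℤ.- + S) ℤ.+ z) ℤ.+ + (a * C)) ∎
  where open ≡-Reasoning
        open import Data.Integer.Solver using (module +-*-Solver)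
        open +-*-Solver

lemma2p5 : (p : ℕ) → Prime p →
    (d e : ℕ) .{{_ : NonZero d}} → 1 ≤ e → e < d → Coprime d e →
    (einv : ℕ) → (e * einv) % d ≡ 1 →
    (t : ℤ) (n : ℕ) (τ : Permutation′ (suc n)) →
    (C : ℕ) → IsC d einv p t n C →
    (+ ((p ∸ 1) * n * suc n) ℤ.+ (+ 2) ℤ.* ((+ suc n) ℤ.* t) ℤ.+ + (2 * (d ∸ e) * C))
    ≤∞ ((2 * d) ·∞ Σ∞ n (λ i → φ d e (arg p t n τ i)))
-- Primality is used only to exclude p = 0.
lemma2p5 zero 0-prime _ _ _ _ _ _ _ _ _ _ _ _ = ⊥-elim (¬prime[0] 0-prime)
lemma2p5 (suc p) _ d e _ e<d _ einv inverse t n τ C (_ , C-minimal) =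
  subst₂ _≤∞_ (sym lhs≡2[K+[d∸e]C]) (·∞-assoc 2 d (Σ∞ n φk))
    (*-mono-≤∞ 2 (≤-≤∞-trans K+[d∸e]C≤Σbound
      (sumℤ-≤∞-·∞-sum∞ d bound φk (φ-bound d e einv inverse (ℕ.<⇒≤ e<d) ∘ k) is)))
  where
  is : List (Fin (suc n))
  is = allFin (suc n)
  k bound : Fin (suc n) → ℤ
  k = arg (suc p) t n τ
  φk : Fin (suc n) → ℕ∞
  φk i = φ d e (k i)
  r : Fin (suc n) → ℕ
  r i = (+ einv ℤ.* k i) ℤ.%ℕ d
  bound i = k i ℤ.+ + ((d ∸ e) * r i)
  K : ℤ
  K = sumℤ (map k is)

  lhs≡2[K+[d∸e]C] : + (p * n * suc n) ℤ.+ + 2 ℤ.* (+ suc n ℤ.* t) ℤ.+ + (2 * (d ∸ e) * C)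
                     ≡ + 2 ℤ.* (K ℤ.+ + ((d ∸ e) * C))
  lhs≡2[K+[d∸e]C] = trans
    (double-rearrange p n (Σℕ n toℕ) (d ∸ e) C (+ suc n ℤ.* t)
      (trans (cong (2 *_) (sum-map-allFin (toℕ {suc n}))) (double-∑-toℕ n)))
    (cong (λ s → + 2 ℤ.* (s ℤ.+ + ((d ∸ e) * C))) (sym (sumℤ-arg (suc p) t n τ)))

  K+[d∸e]C≤Σbound : K ℤ.+ + ((d ∸ e) * C) ℤ.≤ sumℤ (map bound is)
  K+[d∸e]C≤Σbound = begin
    K ℤ.+ + ((d ∸ e) * C)            ≤⟨ ℤ.+-monoʳ-≤ K (ℤ.+≤+ (ℕ.*-monoʳ-≤ (d ∸ e) (C-minimal τ))) ⟩
    K ℤ.+ + ((d ∸ e) * Σℕ n r)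
      ≡⟨ cong (λ s → K ℤ.+ s) (trans (sumℤ-map-pos _ is) (cong +_ (sum-map-*ˡ (d ∸ e) r is))) ⟨
    K ℤ.+ sumℤ (map (λ i → + ((d ∸ e) * r i)) is)
      ≡⟨ sumℤ-map-+ k (λ i → + ((d ∸ e) * r i)) is ⟨
    sumℤ (map bound is)              ∎
    where open ℤ.≤-Reasoning
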